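{- Let $K_n$ be the complete graph on $n \ge 3$ vertices and let $\emptyset \neq Q \subseteq V(K_n)$. Then there exists a unique maximal absolute $c_Q$-visible set of $K_n$.
   Context: For a graph $G$ and $X \subseteq V(G)$, two vertices $u,v$ are $X$-visible if there exists a shortest $(u,v)$-path $P$ in $G$ with $V(P)\cap X \subseteq \{u,v\}$; a set $Y$ is $X$-visible if every two vertices of $Y$ are $X$-visible. A set $X\subseteq V(G)$ is a mutual-visibility set of $G$ if it is $X$-visible. For $Q\subseteq V(G)$, a set $W\subseteq \overline{Q}=V(G)\setminus Q$ is $c_Q$-visible if $W$ is $Q$-visible and $u,w$ are $Q$-visible for all $u\in Q$, $w\in W$; it is an absolute $c_Q$-visible set if moreover $Q$ is a mutual-visibility set of $G$. An absolute $c_Q$-visible set is maximal if it is not a proper subset of any other absolute $c_Q$-visible set. -}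

module Defs where

open import Data.Nat using (ℕ; zero; suc; _≤_)
open import Data.Fin using (Fin)
open import Data.Fin.Subset using (Subset; _∈_; _⊆_; ∁)
open import Data.List using (List; []; _∷_)
open import Data.List.Relation.Unary.Unique.Propositional using (Unique)
import Data.List.Membership.Propositional as LM
open import Data.Product using (Σ; _×_)
open import Data.Sum using (_⊎_)
open import Relation.Binary.PropositionalEquality using (_≡_; _≢_)
open import Relation.Nullary using (¬_)

module _ {n : ℕ} (Adj : Fin n → Fin n → Set) where

  data Walk : Fin n → Fin n → Set where
    []  : ∀ {u} → Walk u u
    _∷_ : ∀ {u w v} → Adj u w → Walk w v → Walk u v

  vertices : ∀ {u v} → Walk u v → List (Fin n)
  vertices {u} []       = u ∷ []
  vertices {u} (_ ∷ p)  = u ∷ vertices p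

  len : ∀ {u v} → Walk u v → ℕ
  len []      = zero
  len (_ ∷ p) = suc (len p)

  IsPath : ∀ {u v} → Walk u v → Set
  IsPath p = Unique (vertices p)

  IsShortestPath : ∀ {u v} → Walk u v → Set
  IsShortestPath {u} {v} p = IsPath p × (∀ (q : Walk u v) → IsPath q → len p ≤ len q)

  Visible : Subset n → Fin n → Fin n → Set
  Visible X u v = Σ (Walk u v) λ p → IsShortestPath p ×
    (∀ x → x LM.∈ vertices p → x ∈ X → (x ≡ u ⊎ x ≡ v))

  VisibleSet : Subset n → Subset n → Set
  VisibleSet X Y = ∀ u v → u ∈ Y → v ∈ Y → Visible X u v

  IsMutualVisibilitySet : Subset n → Set
  IsMutualVisibilitySet X = VisibleSet X X

  IsCVisible : Subset n → Subset n → Set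
  IsCVisible Q W = (W ⊆ ∁ Q) × VisibleSet Q W × (∀ u w → u ∈ Q → w ∈ W → Visible Q u w)

  IsAbsoluteCVisible : Subset n → Subset n → Set
  IsAbsoluteCVisible Q W = IsCVisible Q W × IsMutualVisibilitySet Q

  _⊂_ : Subset n → Subset n → Set
  W ⊂ W' = (W ⊆ W') × (W ≢ W')

  IsMaximalAbsoluteCVisible : Subset n → Subset n → Set
  IsMaximalAbsoluteCVisible Q W =
    IsAbsoluteCVisible Q W × (∀ W' → IsAbsoluteCVisible Q W' → ¬ (W ⊂ W'))

K : (n : ℕ) → Fin n → Fin n → Set
K n u v = u ≢ v

{-# OPTIONS --safe #-}
module Submission where

-- Every absolute c_Q-visible set lies in the complement of Q by definition, so
-- as soon as the complement itself is absolute c_Q-visible it is the greatest,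
-- hence the unique maximal, one. In K_n this is the case for every Q, because
-- any two distinct vertices are joined by a single edge, a shortest path with
-- no interior vertex.

open import Defs
open import Data.Nat using (ℕ; _≤_; z≤n; s≤s)
open import Data.Fin using (Fin; _≟_)
open import Data.Fin.Subset using (Subset; Nonempty; ∁; _⊆_)
open import Data.Fin.Subset.Properties using (⊆-antisym)
open import Data.Bool.Properties using () renaming (_≟_ to _≟ᵇ_)
open import Data.Vec.Properties using (≡-dec)
open import Data.Product using (Σ; _×_; _,_; proj₁)
open import Data.Sum using (inj₁; inj₂)
open import Data.Empty using (⊥-elim)
open import Data.List.Relation.Unary.Any using (here; there)
open import Data.List.Relation.Unary.AllPairs using ([]; _∷_)
open import Data.List.Relation.Unary.All using ([]; _∷_)
open import Relation.Binary.PropositionalEquality using (_≡_; _≢_; refl)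
open import Relation.Nullary using (yes; no)
open import Relation.Nullary.Decidable using (decidable-stable)

module _ {n : ℕ} {Adj : Fin n → Fin n → Set} {Q : Subset n} where

  allVisible⇒∁-absoluteCVisible : (∀ u v → Visible Adj Q u v) →
                                  IsAbsoluteCVisible Adj Q (∁ Q)
  allVisible⇒∁-absoluteCVisible vis =
    ((λ w∈∁Q → w∈∁Q) , (λ u v _ _ → vis u v) , (λ u w _ _ → vis u w)) ,
    (λ u v _ _ → vis u v)

  ∁-absoluteCVisible⇒maximal : IsAbsoluteCVisible Adj Q (∁ Q) →
                               IsMaximalAbsoluteCVisible Adj Q (∁ Q)
  ∁-absoluteCVisible⇒maximal abs∁Q = abs∁Q , λ W absW (∁Q⊆W , ∁Q≢W) →
    ∁Q≢W (⊆-antisym ∁Q⊆W (proj₁ (proj₁ absW)))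

  ∁-absoluteCVisible⇒maximal-unique : IsAbsoluteCVisible Adj Q (∁ Q) →
    ∀ W → IsMaximalAbsoluteCVisible Adj Q W → W ≡ ∁ Q
  ∁-absoluteCVisible⇒maximal-unique abs∁Q W (((W⊆∁Q , _) , _) , maxW) =
    decidable-stable (≡-dec _≟ᵇ_ W (∁ Q)) λ W≢∁Q → maxW (∁ Q) abs∁Q (W⊆∁Q , W≢∁Q)

module _ {n : ℕ} where

  K-walk-length-positive : ∀ {u v} → u ≢ v → (p : Walk (K n) u v) → 1 ≤ len (K n) p
  K-walk-length-positive u≢v []      = ⊥-elim (u≢v refl)
  K-walk-length-positive u≢v (_ ∷ _) = s≤s z≤n

  K-edge-isShortestPath : ∀ {u v} (u≢v : u ≢ v) → IsShortestPath (K n) (u≢v ∷ [])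
  K-edge-isShortestPath u≢v =
    ((u≢v ∷ []) ∷ [] ∷ []) , λ p _ → K-walk-length-positive u≢v p

  K-visible : ∀ X u v → Visible (K n) X u v
  K-visible X u v with u ≟ v
  ... | yes refl = [] , (([] ∷ []) , λ _ _ → z≤n) , λ { _ (here x≡u) _ → inj₁ x≡u }
  ... | no u≢v   = (u≢v ∷ []) , K-edge-isShortestPath u≢v ,
                   λ { _ (here x≡u) _ → inj₁ x≡u ; _ (there (here x≡v)) _ → inj₂ x≡v }

mainTheorem16 : ∀ n → 3 ≤ n → (Q : Subset n) → Nonempty Q →
    Σ (Subset n) λ W → IsMaximalAbsoluteCVisible (K n) Q W ×
      (∀ W' → IsMaximalAbsoluteCVisible (K n) Q W' → W' ≡ W)
mainTheorem16 n _ Q _ =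
  ∁ Q , ∁-absoluteCVisible⇒maximal abs∁Q , ∁-absoluteCVisible⇒maximal-unique abs∁Q
  where
  abs∁Q : IsAbsoluteCVisible (K n) Q (∁ Q)
  abs∁Q = allVisible⇒∁-absoluteCVisible (K-visible Q)
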